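{- For every integer $s\geq 1$, the complete bipartite graph $K_{2s,2s}$ satisfies $\mathrm{av}(K_{2s,2s})=2s-1$.
   Context: An Eulerian circuit is a closed trail traversing every edge exactly once. For an Eulerian graph with $m$ edges and vertex $x$, two Eulerian circuits $x,v_1,\ldots,v_{m-1},x$ and $x,w_1,\ldots,w_{m-1},x$ are avoiding if for each $1\le i\le m-1$, $v_i\ne w_i$ and $v_i,w_i$ are non-adjacent; a set of Eulerian circuits is mutually avoiding if they are pairwise avoiding. The avoidance index $\mathrm{av}(G)$ of an Eulerian graph $G$ is the largest $k$ such that for every vertex $x$ there is a set of $k$ mutually avoiding Eulerian circuits starting and ending at $x$. -}

module Defs where

open import Level using (0ℓ)
open import Data.Nat using (ℕ; zero; suc; _≤_; _<_)
open import Data.Fin using (Fin)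
open import Data.Sum using (_⊎_; inj₁; inj₂)
open import Data.Product using (_×_; Σ; ∃; ∃-syntax)
open import Data.Unit using (⊤)
open import Data.Empty using (⊥)
open import Relation.Nullary using (¬_)
open import Relation.Binary.PropositionalEquality using (_≡_; _≢_)

record Graph : Set₁ where
  field
    V      : Set
    Adj    : V → V → Set
    sym    : ∀ {u v} → Adj u v → Adj v u
    irrefl : ∀ {u} → ¬ Adj u u
open Graph public

KBip-Adj : (p q : ℕ) → Fin p ⊎ Fin q → Fin p ⊎ Fin q → Set
KBip-Adj p q (inj₁ _) (inj₂ _) = ⊤
KBip-Adj p q (inj₂ _) (inj₁ _) = ⊤
KBip-Adj p q (inj₁ _) (inj₁ _) = ⊥
KBip-Adj p q (inj₂ _) (inj₂ _) = ⊥

K : ℕ → ℕ → Graph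
K p q = record
  { V = Fin p ⊎ Fin q
  ; Adj = KBip-Adj p q
  ; sym = λ { {inj₁ _} {inj₂ _} _ → _ ; {inj₂ _} {inj₁ _} _ → _
            ; {inj₁ _} {inj₁ _} () ; {inj₂ _} {inj₂ _} () }
  ; irrefl = λ { {inj₁ _} () ; {inj₂ _} () }
  }

SameEdge : {A : Set} → A → A → A → A → Set
SameEdge a b c d = (a ≡ c × b ≡ d) ⊎ (a ≡ d × b ≡ c)

-- An Eulerian circuit of G starting and ending at x: a closed walk
-- x = w 0, w 1, ..., w m = x (values of w beyond m are irrelevant)
-- which traverses every edge of G exactly once.
record EulerianCircuit (G : Graph) (x : V G) : Set where
  field
    len   : ℕ
    walk  : ℕ → V G
    start : walk 0 ≡ x
    end   : walk len ≡ x
    step  : ∀ i → i < len → Adj G (walk i) (walk (suc i))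
    once  : ∀ i j → i < len → j < len →
            SameEdge (walk i) (walk (suc i)) (walk j) (walk (suc j)) → i ≡ j
    every : ∀ u v → Adj G u v →
            ∃[ i ] (i < len × SameEdge (walk i) (walk (suc i)) u v)
open EulerianCircuit public

-- Two Eulerian circuits x,v_1..v_{m-1},x and x,w_1..w_{m-1},x are avoiding
-- if for each 1 ≤ i ≤ m-1, v_i ≠ w_i and v_i, w_i are non-adjacent.
-- (Both circuits have m = number of edges, so len C = len D.)
Avoiding : (G : Graph) {x : V G} → EulerianCircuit G x → EulerianCircuit G x → Set
Avoiding G C D = ∀ i → 1 ≤ i → suc i ≤ len C →
  (walk C i ≢ walk D i) × ¬ Adj G (walk C i) (walk D i)

MutuallyAvoiding : (G : Graph) {x : V G} (k : ℕ) → (Fin k → EulerianCircuit G x) → Set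
MutuallyAvoiding G k C = ∀ a b → a ≢ b → Avoiding G (C a) (C b)

HasAvoiding : Graph → ℕ → Set
HasAvoiding G k = ∀ (x : V G) → Σ (Fin k → EulerianCircuit G x) (MutuallyAvoiding G k)

AvIndexIs : Graph → ℕ → Set
AvIndexIs G k = HasAvoiding G k × (∀ k' → k < k' → ¬ HasAvoiding G k')

-- Upper bound: two steps into a circuit from x one is at a vertex of x's side other than
-- x, and mutually avoiding circuits must be at different such vertices there, so there
-- are at most n - 1 of them in K_{n,n}.
--
-- Lower bound: K_{n,n} is vertex-transitive, so it suffices to find n - 1 mutually
-- avoiding circuits from one vertex 0.  For n = 2s an Eulerian circuit can be run in s
-- rounds: round j passes through the whole first side in some order, starting and ending
-- at a common vertex, while alternating between two second-side vertices; as n is even,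
-- each of those two meets every first-side vertex exactly once.  Taking the orders to be
-- translates by c (modulo n, and modulo n - 1 on the nonzero vertices in the last round,
-- which ends at 0) and rotating each circuit to start at 0 gives, for c < n - 1, circuits
-- that at every inner position sit at distinct vertices of one side.

module Submission where

open import Defs hiding (sym)
open import Data.Empty using (⊥-elim)
open import Data.Fin.Base using (Fin; toℕ; punchOut) renaming (zero to fzero; suc to fsuc)
open import Data.Fin.Permutation using (Permutation′; _⟨$⟩ʳ_; _⟨$⟩ˡ_; inverseˡ; inverseʳ; transpose)
open import Data.Fin.Properties
  using (toℕ<n; toℕ-injective; toℕ-fromℕ<; fromℕ<-injective; any?; injective⇒≤; punchOut-injective)
  renaming (_≟_ to _≟ᶠ_; suc-injective to fsuc-injective)
open import Data.Nat.Base
  using (ℕ; zero; suc; _+_; _*_; _≤_; _<_; _∸_; z≤n; s≤s; z<s; s<s; NonZero; pred; parity; ⌊_/2⌋)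
open import Data.Nat.DivMod
open import Data.Nat.Divisibility using (n∣m*n)
open import Data.Nat.Properties
open import Data.Parity.Base using (Parity; 0ℙ; 1ℙ; _⁻¹)
open import Data.Parity.Properties using (⁻¹-selfInverse; suc-homo-⁻¹; p≢p⁻¹) renaming (_≟_ to _≟ᵖ_)
open import Data.Product using (_×_; _,_; proj₁; proj₂; Σ; ∃-syntax; ∃₂)
open import Data.Sum using (_⊎_; inj₁; inj₂)
open import Function.Base using (_∘_)
open import Relation.Binary.PropositionalEquality
open import Relation.Nullary using (¬_; yes; no)

double : ℕ → ℕ
double zero    = zero
double (suc n) = suc (suc (double n))

double+ : ℕ → Parity → ℕ
double+ j 0ℙ = double j
double+ j 1ℙ = suc (double j)

data EvenOdd : ℕ → Set where
  even : ∀ U → EvenOdd (double U)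
  odd  : ∀ U → EvenOdd (suc (double U))

evenOdd : ∀ t → EvenOdd t
evenOdd zero          = even zero
evenOdd (suc zero)    = odd zero
evenOdd (suc (suc t)) with evenOdd t
... | even U = even (suc U)
... | odd U  = odd (suc U)

double+-surjective : ∀ v → ∃₂ λ j p → double+ j p ≡ v
double+-surjective v with evenOdd v
... | even j = j , 0ℙ , refl
... | odd j  = j , 1ℙ , refl

parity-double+ : ∀ j p → parity (double+ j p) ≡ p
parity-double+ zero    0ℙ = refl
parity-double+ zero    1ℙ = refl
parity-double+ (suc j) 0ℙ = parity-double+ j 0ℙ
parity-double+ (suc j) 1ℙ = parity-double+ j 1ℙ

⌊double+/2⌋ : ∀ j p → ⌊ double+ j p /2⌋ ≡ j
⌊double+/2⌋ zero    0ℙ = refl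
⌊double+/2⌋ zero    1ℙ = refl
⌊double+/2⌋ (suc j) 0ℙ = cong suc (⌊double+/2⌋ j 0ℙ)
⌊double+/2⌋ (suc j) 1ℙ = cong suc (⌊double+/2⌋ j 1ℙ)

double+-injective : ∀ {j j' p p'} → double+ j p ≡ double+ j' p' → j ≡ j' × p ≡ p'
double+-injective {j} {j'} {p} {p'} eq =
  trans (sym (⌊double+/2⌋ j p)) (trans (cong ⌊_/2⌋ eq) (⌊double+/2⌋ j' p')) ,
  trans (sym (parity-double+ j p)) (trans (cong parity eq) (parity-double+ j' p'))

double+-mono-< : ∀ {j s} p → j < s → double+ j p < double s
double+-mono-< {zero}  {suc s} 0ℙ _ = z<s
double+-mono-< {zero}  {suc s} 1ℙ _ = s<s z<s
double+-mono-< {suc j} {suc s} 0ℙ (s<s j<s) = s<s (s<s (double+-mono-< 0ℙ j<s))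
double+-mono-< {suc j} {suc s} 1ℙ (s<s j<s) = s<s (s<s (double+-mono-< 1ℙ j<s))

double+-cancel-< : ∀ {j s} p → double+ j p < double s → j < s
double+-cancel-< {zero}  {suc s} _ _ = z<s
double+-cancel-< {suc j} {suc s} 0ℙ (s<s (s<s lt)) = s<s (double+-cancel-< 0ℙ lt)
double+-cancel-< {suc j} {suc s} 1ℙ (s<s (s<s lt)) = s<s (double+-cancel-< 1ℙ lt)

parity-suc : ∀ n → parity (suc n) ≡ parity n ⁻¹
parity-suc n = sym (⁻¹-selfInverse (suc-homo-⁻¹ n))

⁻¹≢⇒≡ : ∀ {p p'} → p ⁻¹ ≢ p' → p ≡ p'
⁻¹≢⇒≡ {0ℙ} {0ℙ} _  = refl
⁻¹≢⇒≡ {0ℙ} {1ℙ} ne = ⊥-elim (ne refl)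
⁻¹≢⇒≡ {1ℙ} {0ℙ} ne = ⊥-elim (ne refl)
⁻¹≢⇒≡ {1ℙ} {1ℙ} _  = refl

InjectiveBelow : {A : Set} → ℕ → (ℕ → A) → Set
InjectiveBelow n f = ∀ {k k'} → k < n → k' < n → f k ≡ f k' → k ≡ k'

injectiveBelow⇒surjective : ∀ {n} (f : ℕ → Fin n) → InjectiveBelow n f →
                            ∀ y → ∃[ k ] (k < n × f k ≡ y)
injectiveBelow⇒surjective {suc m} f f-inj y with any? (λ i → f (toℕ i) ≟ᶠ y)
... | yes (i , fi≡y) = toℕ i , toℕ<n i , fi≡y
... | no  y∉image = ⊥-elim (1+n≰n (injective⇒≤ avoid-y-injective))
  where
  avoid-y : Fin (suc m) → Fin m
  avoid-y i = punchOut (λ y≡fi → y∉image (i , sym y≡fi))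
  avoid-y-injective : ∀ {i i'} → avoid-y i ≡ avoid-y i' → i ≡ i'
  avoid-y-injective {i} {i'} eq =
    toℕ-injective (f-inj (toℕ<n i) (toℕ<n i') (punchOut-injective {i = y} _ _ eq))

mod⇒% : ∀ a b {n} .{{_ : NonZero n}} → a mod n ≡ b mod n → a % n ≡ b % n
mod⇒% a b {n} = fromℕ<-injective (a % n) (b % n) (m%n<n a n) (m%n<n b n)

module _ {n : ℕ} .{{_ : NonZero n}} where

  %-absorbˡ : ∀ a b → (a % n + b) % n ≡ (a + b) % n
  %-absorbˡ a b = begin
    (a % n + b) % n           ≡⟨ %-distribˡ-+ (a % n) b n ⟩
    (a % n % n + b % n) % n   ≡⟨ cong (λ x → (x + b % n) % n) (m%n%n≡m%n a n) ⟩
    (a % n + b % n) % n       ≡⟨ %-distribˡ-+ a b n ⟨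
    (a + b) % n               ∎
    where open ≡-Reasoning

  +-%-inverse : ∀ {d} k → d < n → ((d + k) % n + (n ∸ k % n)) % n ≡ d
  +-%-inverse {d} k d<n = begin
    ((d + k) % n + (n ∸ r)) % n     ≡⟨ %-absorbˡ (d + k) (n ∸ r) ⟩
    (d + k + (n ∸ r)) % n           ≡⟨ cong (_% n) (+-assoc d k (n ∸ r)) ⟩
    (d + (k + (n ∸ r))) % n         ≡⟨ cong (λ x → (d + (x + (n ∸ r))) % n) (m≡m%n+[m/n]*n k n) ⟩
    (d + (r + Q + (n ∸ r))) % n     ≡⟨ cong (λ x → (d + x) % n) (xy∙z≈xz∙y r Q (n ∸ r)) ⟩
    (d + (r + (n ∸ r) + Q)) % n     ≡⟨ cong (λ x → (d + (x + Q)) % n) (m+[n∸m]≡n (<⇒≤ (m%n<n k n))) ⟩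
    (d + suc (k / n) * n) % n       ≡⟨ [m+kn]%n≡m%n d (suc (k / n)) n ⟩
    d % n                           ≡⟨ m<n⇒m%n≡m d<n ⟩
    d                               ∎
    where
    open ≡-Reasoning
    open import Algebra.Properties.CommutativeSemigroup +-commutativeSemigroup using (xy∙z≈xz∙y)
    r = k % n
    Q = k / n * n

  +-%-injectiveˡ : ∀ k → InjectiveBelow n (λ d → (d + k) % n)
  +-%-injectiveˡ k {d} {d'} d<n d'<n eq =
    trans (sym (+-%-inverse k d<n)) (trans (cong (λ x → (x + (n ∸ k % n)) % n) eq) (+-%-inverse k d'<n))

  +-%-injectiveʳ : ∀ k → InjectiveBelow n (λ d → (k + d) % n)
  +-%-injectiveʳ k {d} {d'} d<n d'<n eq =
    +-%-injectiveˡ k d<n d'<n (trans (cong (_% n) (+-comm d k)) (trans eq (cong (_% n) (+-comm k d'))))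

  block-/ : ∀ {k} j → k < n → (k + j * n) / n ≡ j
  block-/ {k} j k<n = trans (+-distrib-/-∣ʳ k (n∣m*n j)) (cong₂ _+_ (m<n⇒m/n≡0 k<n) (m*n/n≡m j n))

  block-% : ∀ {k} j → k < n → (k + j * n) % n ≡ k
  block-% {k} j k<n = trans ([m+kn]%n≡m%n k j n) (m<n⇒m%n≡m k<n)

  /-%-injective : ∀ {U U'} → U / n ≡ U' / n → U % n ≡ U' % n → U ≡ U'
  /-%-injective {U} {U'} eq/ eq% = begin
    U                   ≡⟨ m≡m%n+[m/n]*n U n ⟩
    U % n + U / n * n   ≡⟨ cong₂ (λ r j → r + j * n) eq% eq/ ⟩
    U' % n + U' / n * n ≡⟨ m≡m%n+[m/n]*n U' n ⟨
    U'                  ∎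
    where open ≡-Reasoning

  block-< : ∀ {k j s} → k < n → j < s → k + j * n < s * n
  block-< {k} {j} k<n j<s = ≤-trans (+-monoˡ-≤ (j * n) k<n) (*-monoˡ-≤ n j<s)

-- Circuits, automorphisms and the upper bound

AvoidingCircuits : (G : Graph) → ℕ → V G → Set
AvoidingCircuits G k x = Σ (Fin k → EulerianCircuit G x) (MutuallyAvoiding G k)

module _ {A : Set} {a b c d : A} where

  SameEdge-swapˡ : SameEdge a b c d → SameEdge b a c d
  SameEdge-swapˡ (inj₁ (a≡c , b≡d)) = inj₂ (b≡d , a≡c)
  SameEdge-swapˡ (inj₂ (a≡d , b≡c)) = inj₁ (b≡c , a≡d)

  SameEdge-swapʳ : SameEdge a b c d → SameEdge a b d c
  SameEdge-swapʳ (inj₁ eqs) = inj₂ eqs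
  SameEdge-swapʳ (inj₂ eqs) = inj₁ eqs

  SameEdge-cong : ∀ {a' b' c' d'} → a ≡ a' → b ≡ b' → c ≡ c' → d ≡ d' →
                  SameEdge a b c d → SameEdge a' b' c' d'
  SameEdge-cong refl refl refl refl same = same

SameEdge-inj : ∀ {A B : Set} {a a' : A} {b b' : B} →
               SameEdge {A ⊎ B} (inj₁ a) (inj₂ b) (inj₁ a') (inj₂ b') → a ≡ a' × b ≡ b'
SameEdge-inj (inj₁ (refl , refl)) = refl , refl

-- There are no loops, and a closed trail of length two would use its edge twice.
circuit-len≥3 : ∀ {G : Graph} {x u v} → Adj G u v → (C : EulerianCircuit G x) → 3 ≤ len C
circuit-len≥3 {G} {u = u} {v} uv C = go (len C) refl
  where
  closed-at : ∀ {m} → len C ≡ m → walk C m ≡ walk C 0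
  closed-at refl = trans (end C) (sym (start C))
  below : ∀ {i m} → len C ≡ m → i < m → i < len C
  below refl i<m = i<m
  go : ∀ m → len C ≡ m → 3 ≤ m
  go 0 eq = let i , i<len , _ = every C u v uv in ⊥-elim (n≮0 (subst (i <_) eq i<len))
  go 1 eq = ⊥-elim (irrefl G (subst (Adj G (walk C 0)) (closed-at eq) (step C 0 (below eq z<s))))
  go 2 eq with once C 0 1 (below eq z<s) (below eq (s<s z<s)) (inj₂ (sym (closed-at eq) , refl))
  ... | ()
  go (suc (suc (suc m))) _ = s≤s (s≤s (s≤s z≤n))

record Automorphism (G : Graph) : Set where
  field
    to from  : V G → V G
    to∘from  : ∀ v → to (from v) ≡ v
    from∘to  : ∀ v → from (to v) ≡ v
    to-adj   : ∀ {u v} → Adj G u v → Adj G (to u) (to v)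
    from-adj : ∀ {u v} → Adj G u v → Adj G (from u) (from v)

  to-injective : ∀ {u v} → to u ≡ to v → u ≡ v
  to-injective {u} {v} eq = trans (sym (from∘to u)) (trans (cong from eq) (from∘to v))

  to-reflects-adj : ∀ {u v} → Adj G (to u) (to v) → Adj G u v
  to-reflects-adj adj = subst₂ (Adj G) (from∘to _) (from∘to _) (from-adj adj)

  map-circuit : ∀ {x} → EulerianCircuit G x → EulerianCircuit G (to x)
  map-circuit C = record
    { len   = len C
    ; walk  = λ i → to (walk C i)
    ; start = cong to (start C)
    ; end   = cong to (end C)
    ; step  = λ i i<len → to-adj (step C i i<len)
    ; once  = λ i j i<len j<len same → once C i j i<len j<len (pull same)
    ; every = λ u v uv → let i , i<len , same = every C (from u) (from v) (from-adj uv)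
                         in i , i<len , push same
    }
    where
    pull : ∀ {a b c d} → SameEdge (to a) (to b) (to c) (to d) → SameEdge a b c d
    pull (inj₁ (p , q)) = inj₁ (to-injective p , to-injective q)
    pull (inj₂ (p , q)) = inj₂ (to-injective p , to-injective q)
    push : ∀ {a b u v} → SameEdge a b (from u) (from v) → SameEdge (to a) (to b) u v
    push (inj₁ (p , q)) = inj₁ (trans (cong to p) (to∘from _) , trans (cong to q) (to∘from _))
    push (inj₂ (p , q)) = inj₂ (trans (cong to p) (to∘from _) , trans (cong to q) (to∘from _))

  map-avoidingCircuits : ∀ {k x} → AvoidingCircuits G k x → AvoidingCircuits G k (to x)
  map-avoidingCircuits (C , avoiding) =
    (λ a → map-circuit (C a)) ,
    λ a b a≢b i 1≤i i<len → let ≢ , ¬adj = avoiding a b a≢b i 1≤i i<len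
                            in (λ eq → ≢ (to-injective eq)) , (λ adj → ¬adj (to-reflects-adj adj))

open Automorphism

_∘ᵃ_ : ∀ {G} → Automorphism G → Automorphism G → Automorphism G
φ ∘ᵃ ψ = record
  { to       = λ v → to φ (to ψ v)
  ; from     = λ v → from ψ (from φ v)
  ; to∘from  = λ v → trans (cong (to φ) (to∘from ψ (from φ v))) (to∘from φ v)
  ; from∘to  = λ v → trans (cong (from ψ) (from∘to φ (to ψ v))) (from∘to ψ v)
  ; to-adj   = λ adj → to-adj φ (to-adj ψ adj)
  ; from-adj = λ adj → from-adj ψ (from-adj φ adj)
  }

transitive⇒hasAvoiding : ∀ {G k} (x₀ : V G) →
  (∀ x → Σ (Automorphism G) λ φ → to φ x₀ ≡ x) →
  AvoidingCircuits G k x₀ → HasAvoiding G k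
transitive⇒hasAvoiding {G} {k} x₀ transitive circuits x =
  let φ , φx₀≡x = transitive x
  in subst (AvoidingCircuits G k) φx₀≡x (map-avoidingCircuits φ circuits)

module _ {n : ℕ} where

  K-swap : Automorphism (K n n)
  K-swap = record
    { to = swap ; from = swap ; to∘from = swap-involutive ; from∘to = swap-involutive
    ; to-adj = λ {u} {v} → swap-adj u v ; from-adj = λ {u} {v} → swap-adj u v }
    where
    swap : Fin n ⊎ Fin n → Fin n ⊎ Fin n
    swap (inj₁ a) = inj₂ a
    swap (inj₂ b) = inj₁ b
    swap-involutive : ∀ v → swap (swap v) ≡ v
    swap-involutive (inj₁ _) = refl
    swap-involutive (inj₂ _) = refl
    swap-adj : ∀ u v → KBip-Adj n n u v → KBip-Adj n n (swap u) (swap v)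
    swap-adj (inj₁ _) (inj₂ _) _ = _
    swap-adj (inj₂ _) (inj₁ _) _ = _

  K-relabel₁ : Permutation′ n → Automorphism (K n n)
  K-relabel₁ π = record
    { to = relabel (π ⟨$⟩ʳ_) ; from = relabel (π ⟨$⟩ˡ_)
    ; to∘from = λ { (inj₁ _) → cong inj₁ (inverseʳ π) ; (inj₂ _) → refl }
    ; from∘to = λ { (inj₁ _) → cong inj₁ (inverseˡ π) ; (inj₂ _) → refl }
    ; to-adj = λ {u} {v} → relabel-adj (π ⟨$⟩ʳ_) u v
    ; from-adj = λ {u} {v} → relabel-adj (π ⟨$⟩ˡ_) u v }
    where
    relabel : (Fin n → Fin n) → Fin n ⊎ Fin n → Fin n ⊎ Fin n
    relabel f (inj₁ a) = inj₁ (f a)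
    relabel f (inj₂ b) = inj₂ b
    relabel-adj : ∀ f u v → KBip-Adj n n u v → KBip-Adj n n (relabel f u) (relabel f v)
    relabel-adj f (inj₁ _) (inj₂ _) _ = _
    relabel-adj f (inj₂ _) (inj₁ _) _ = _

module _ {p q : ℕ} {u v : Fin p ⊎ Fin q} where

  K-separated₁ : ∀ {a a'} → u ≡ inj₁ a → v ≡ inj₁ a' → a ≢ a' → (u ≢ v) × ¬ KBip-Adj p q u v
  K-separated₁ refl refl a≢a' = (λ { refl → a≢a' refl }) , λ ()

  K-separated₂ : ∀ {b b'} → u ≡ inj₂ b → v ≡ inj₂ b' → b ≢ b' → (u ≢ v) × ¬ KBip-Adj p q u v
  K-separated₂ refl refl b≢b' = (λ { refl → b≢b' refl }) , λ ()

K-transitive : ∀ {m} (x : Fin (suc m) ⊎ Fin (suc m)) →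
               Σ (Automorphism (K (suc m) (suc m))) λ φ → to φ (inj₁ fzero) ≡ x
K-transitive (inj₁ a) = K-relabel₁ (transpose fzero a) , refl
K-transitive (inj₂ b) = K-swap ∘ᵃ K-relabel₁ (transpose fzero b) , refl

module _ {G : Graph} {x y : V G} (L : ℕ) (C : EulerianCircuit G y)
         (len≡ : len C ≡ suc L) (last≡x : walk C L ≡ x) where

  private
    w : ℕ → V G
    w zero    = walk C L
    w (suc t) = walk C t

    source : ℕ → ℕ
    source zero    = L
    source (suc i) = i

    closed : walk C 0 ≡ walk C (suc L)
    closed = trans (start C) (trans (sym (end C)) (cong (walk C) len≡))

    w-source : ∀ i → w i ≡ walk C (source i)
    w-source zero    = refl
    w-source (suc i) = refl

    w-source-suc : ∀ i → w (suc i) ≡ walk C (suc (source i))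
    w-source-suc zero    = closed
    w-source-suc (suc i) = refl

    source-< : ∀ {i} → i < suc L → source i < len C
    source-< {zero}  _          = subst (L <_) (sym len≡) (n<1+n L)
    source-< {suc i} (s<s i<L) = subst (i <_) (sym len≡) (<-trans i<L (n<1+n L))

    source-injective : InjectiveBelow (suc L) source
    source-injective {zero}  {zero}   _ _ _ = refl
    source-injective {suc i} {suc i'} _ _ eq = cong suc eq
    source-injective {zero}  {suc i'} _ (s<s i'<L) eq = ⊥-elim (<-irrefl (sym eq) i'<L)
    source-injective {suc i} {zero}   (s<s i<L) _ eq = ⊥-elim (<-irrefl eq i<L)

    source-surjective : ∀ {i} → i < len C → ∃[ i' ] (i' < suc L × source i' ≡ i)
    source-surjective {i} i<len with i ≟ L
    ... | yes refl = zero , z<s , refl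
    ... | no  i≢L  = suc i , s<s (≤∧≢⇒< (≤-pred (subst (i <_) len≡ i<len)) i≢L) , refl

  rotate : EulerianCircuit G x
  rotate = record
    { len   = suc L
    ; walk  = w
    ; start = last≡x
    ; end   = last≡x
    ; step  = λ i i<len →
        subst₂ (Adj G) (sym (w-source i)) (sym (w-source-suc i)) (step C (source i) (source-< i<len))
    ; once  = λ i j i<len j<len same →
        source-injective i<len j<len
          (once C (source i) (source j) (source-< i<len) (source-< j<len)
            (SameEdge-cong (w-source i) (w-source-suc i) (w-source j) (w-source-suc j) same))
    ; every = λ u v uv →
        let i , i<len , same = every C u v uv
            i' , i'<len , source≡ = source-surjective i<len
        in i' , i'<len ,
           SameEdge-cong (sym (trans (w-source i') (cong (walk C) source≡)))
                         (sym (trans (w-source-suc i') (cong (walk C ∘ suc) source≡))) refl refl same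
    }

module _ {q : ℕ} where

  private
    G = K (suc q) (suc q)

  len≥3 : (C : EulerianCircuit G (inj₁ fzero)) → 3 ≤ len C
  len≥3 = circuit-len≥3 {u = inj₁ fzero} {v = inj₂ fzero} _

  -- Two steps from a vertex of a bipartite graph lead back to its side, but not to the
  -- vertex itself, since the second edge would repeat the first.
  third-vertex : (C : EulerianCircuit G (inj₁ fzero)) → ∃[ a ] walk C 2 ≡ inj₁ (fsuc a)
  third-vertex C = go (walk C 1) (walk C 2) refl refl
    where
    0<len : 0 < len C
    0<len = <-trans z<s (len≥3 C)
    1<len : 1 < len C
    1<len = <-trans (s<s z<s) (len≥3 C)
    go : ∀ u w → walk C 1 ≡ u → walk C 2 ≡ w → ∃[ a ] w ≡ inj₁ (fsuc a)
    go u (inj₁ fzero) _ w₂≡x with once C 0 1 0<len 1<len (inj₂ (trans (start C) (sym w₂≡x) , refl))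
    ... | ()
    go u (inj₁ (fsuc a)) _ _ = a , refl
    go (inj₁ u) (inj₂ w) w₁≡u _ = ⊥-elim (subst₂ (KBip-Adj (suc q) (suc q)) (start C) w₁≡u (step C 0 0<len))
    go (inj₂ u) (inj₂ w) w₁≡u w₂≡w = ⊥-elim (subst₂ (KBip-Adj (suc q) (suc q)) w₁≡u w₂≡w (step C 1 1<len))

  avoidingCircuits-bound : ∀ {k} → AvoidingCircuits G k (inj₁ fzero) → k ≤ q
  avoidingCircuits-bound {k} (C , avoiding) = injective⇒≤ third-injective
    where
    third : Fin k → Fin q
    third a = proj₁ (third-vertex (C a))
    third-injective : ∀ {a b} → third a ≡ third b → a ≡ b
    third-injective {a} {b} eq with a ≟ᶠ b
    ... | yes a≡b = a≡b
    ... | no  a≢b = ⊥-elim (proj₁ (avoiding a b a≢b 2 (s≤s z≤n) (len≥3 (C a))) same-third)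
      where
      same-third : walk (C a) 2 ≡ walk (C b) 2
      same-third = trans (proj₂ (third-vertex (C a)))
                         (trans (cong (inj₁ ∘ fsuc) eq) (sym (proj₂ (third-vertex (C b)))))

-- Circuits of K_{2s,2s} run in rounds

interleave : {A B : Set} → (ℕ → A) → (ℕ → B) → ℕ → A ⊎ B
interleave a b zero          = inj₁ (a 0)
interleave a b (suc zero)    = inj₂ (b 0)
interleave a b (suc (suc t)) = interleave (a ∘ suc) (b ∘ suc) t

interleave-even : ∀ {A B : Set} (a : ℕ → A) (b : ℕ → B) U → interleave a b (double U) ≡ inj₁ (a U)
interleave-even a b zero    = refl
interleave-even a b (suc U) = interleave-even (a ∘ suc) (b ∘ suc) U

interleave-odd : ∀ {A B : Set} (a : ℕ → A) (b : ℕ → B) U → interleave a b (suc (double U)) ≡ inj₂ (b U)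
interleave-odd a b zero    = refl
interleave-odd a b (suc U) = interleave-odd (a ∘ suc) (b ∘ suc) U

-- Round j visits the first side in the order P j 0, ..., P j (n - 1), then the next
-- round's start z, alternating between the second-side vertices B (2j) and B (2j + 1):
-- unit U = k + j n of the walk is the pair of edges from P j k through B (2j + parity k)
-- to P j (k + 1 mod n).
module Rounds (s' : ℕ) where

  s n : ℕ
  s = suc s'
  n = double s

  cyc : ℕ → ℕ
  cyc k = suc k % n

  cyc-injective : InjectiveBelow n cyc
  cyc-injective = +-%-injectiveʳ 1

  parity-cyc : ∀ {k} → k < n → parity (cyc k) ≡ parity k ⁻¹
  parity-cyc {k} k<n with suc k <? n
  ... | yes k+1<n = trans (cong parity (m<n⇒m%n≡m k+1<n)) (parity-suc k)
  ... | no  k+1≮n = begin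
    parity (suc k % n)              ≡⟨ cong (λ m → parity (m % n)) k+1≡n ⟩
    parity (n % n)                  ≡⟨ cong parity (n%n≡0 n) ⟩
    0ℙ                              ≡⟨ cong _⁻¹ (parity-double+ s' 1ℙ) ⟨
    parity (suc (double s')) ⁻¹     ≡⟨ cong (λ m → parity m ⁻¹) (suc-injective k+1≡n) ⟨
    parity k ⁻¹                     ∎
    where
    open ≡-Reasoning
    k+1≡n : suc k ≡ n
    k+1≡n = ≤-antisym k<n (≮⇒≥ k+1≮n)

  cyc-surjective : ∀ {k} → k < n → ∃[ k' ] (k' < n × cyc k' ≡ k)
  cyc-surjective {zero}  _       = pred n , n<1+n (pred n) , n%n≡0 n
  cyc-surjective {suc k} k+1<n = k , <-trans (n<1+n k) k+1<n , m<n⇒m%n≡m k+1<n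

  module Walk (P : ℕ → ℕ → Fin n) (B : ℕ → Fin n) (z : Fin n)
           (P-injective : ∀ j → j < s → InjectiveBelow n (P j))
           (P-start : ∀ j → P j 0 ≡ z)
           (B-injective : InjectiveBelow n B) where

    N : ℕ
    N = s * n

    left right : ℕ → Fin n
    left U  = P (U / n) (U % n)
    right U = B (double+ (U / n) (parity (U % n)))

    tour : ℕ → Fin n ⊎ Fin n
    tour = interleave left right

    left-block : ∀ {k} j → k < n → left (k + j * n) ≡ P j k
    left-block j k<n = cong₂ P (block-/ j k<n) (block-% j k<n)

    right-block : ∀ {k} j → k < n → right (k + j * n) ≡ B (double+ j (parity k))
    right-block j k<n = cong₂ (λ j' k' → B (double+ j' (parity k'))) (block-/ j k<n) (block-% j k<n)

    left-suc : ∀ U → left (suc U) ≡ P (U / n) (cyc (U % n))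
    left-suc U with suc (U % n) <? n
    ... | yes k+1<n = begin
      left (suc U)                     ≡⟨ cong (left ∘ suc) (m≡m%n+[m/n]*n U n) ⟩
      left (suc (U % n) + U / n * n)   ≡⟨ left-block (U / n) k+1<n ⟩
      P (U / n) (suc (U % n))          ≡⟨ cong (P (U / n)) (m<n⇒m%n≡m k+1<n) ⟨
      P (U / n) (cyc (U % n))          ∎
      where open ≡-Reasoning
    ... | no  k+1≮n = begin
      left (suc U)                     ≡⟨ cong (left ∘ suc) (m≡m%n+[m/n]*n U n) ⟩
      left (suc (U % n) + U / n * n)   ≡⟨ cong (λ m → left (m + U / n * n)) k+1≡n ⟩
      left (0 + suc (U / n) * n)       ≡⟨ left-block (suc (U / n)) z<s ⟩
      P (suc (U / n)) 0                ≡⟨ trans (P-start _) (sym (P-start _)) ⟩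
      P (U / n) 0                      ≡⟨ cong (P (U / n)) (n%n≡0 n) ⟨
      P (U / n) (n % n)                ≡⟨ cong (λ m → P (U / n) (m % n)) k+1≡n ⟨
      P (U / n) (cyc (U % n))          ∎
      where
      open ≡-Reasoning
      k+1≡n : suc (U % n) ≡ n
      k+1≡n = ≤-antisym (m%n<n U n) (≮⇒≥ k+1≮n)

    tour-even : ∀ U → tour (double U) ≡ inj₁ (left U)
    tour-even = interleave-even left right

    tour-odd : ∀ U → tour (suc (double U)) ≡ inj₂ (right U)
    tour-odd = interleave-odd left right

    round-< : ∀ {U} → U < N → U / n < s
    round-< {U} U<N = m<n*o⇒m/o<n {U} {s} {n} U<N

    right-determines : ∀ {U U'} → U < N → U' < N → right U ≡ right U' →
                       U / n ≡ U' / n × parity (U % n) ≡ parity (U' % n)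
    right-determines {U} {U'} U<N U'<N eq =
      double+-injective (B-injective (double+-mono-< (parity (U % n)) (round-< U<N))
                                     (double+-mono-< (parity (U' % n)) (round-< U'<N)) eq)

    once-even-even : ∀ {U U'} → U < N → U' < N → left U ≡ left U' → right U ≡ right U' → U ≡ U'
    once-even-even {U} {U'} U<N U'<N eqˡ eqʳ =
      let same-round , _ = right-determines U<N U'<N eqʳ
      in /-%-injective same-round
           (P-injective (U / n) (round-< U<N) (m%n<n U n) (m%n<n U' n)
             (trans eqˡ (cong (λ j → P j (U' % n)) (sym same-round))))

    once-odd-odd : ∀ {U U'} → U < N → U' < N → left (suc U) ≡ left (suc U') → right U ≡ right U' → U ≡ U'
    once-odd-odd {U} {U'} U<N U'<N eqˡ eqʳ =
      let same-round , _ = right-determines U<N U'<N eqʳ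
      in /-%-injective same-round
           (cyc-injective (m%n<n U n) (m%n<n U' n)
             (P-injective (U / n) (round-< U<N) (m%n<n (suc (U % n)) n) (m%n<n (suc (U' % n)) n)
               (trans (sym (left-suc U)) (trans eqˡ (trans (left-suc U')
                 (cong (λ j → P j (cyc (U' % n))) (sym same-round)))))))

    -- Within a round, the second-side vertex met at unit U is determined by the parity
    -- of U % n, and cyc flips that parity because n is even.
    once-even-odd : ∀ {U U'} → U < N → U' < N → left U ≡ left (suc U') → right U ≢ right U'
    once-even-odd {U} {U'} U<N U'<N eqˡ eqʳ =
      let same-round , same-parity = right-determines U<N U'<N eqʳ
          k≡cyc = P-injective (U / n) (round-< U<N) (m%n<n U n) (m%n<n (suc (U' % n)) n)
                    (trans eqˡ (trans (left-suc U') (cong (λ j → P j (cyc (U' % n))) (sym same-round))))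
      in p≢p⁻¹ (parity (U' % n))
           (trans (sym same-parity) (trans (cong parity k≡cyc) (parity-cyc (m%n<n U' n))))

    tour-once : ∀ i i' → i < double N → i' < double N →
                 SameEdge (tour i) (tour (suc i)) (tour i') (tour (suc i')) → i ≡ i'
    tour-once i i' i<2N i'<2N same with evenOdd i | evenOdd i'
    ... | even U | even U' =
      let eqˡ , eqʳ = SameEdge-inj (SameEdge-cong (tour-even U) (tour-odd U) (tour-even U') (tour-odd U') same)
      in cong double (once-even-even (double+-cancel-< 0ℙ i<2N) (double+-cancel-< 0ℙ i'<2N) eqˡ eqʳ)
    ... | odd U | odd U' =
      let eqˡ , eqʳ = SameEdge-inj (SameEdge-swapˡ (SameEdge-swapʳ
                        (SameEdge-cong (tour-odd U) (tour-even (suc U)) (tour-odd U') (tour-even (suc U')) same)))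
      in cong (suc ∘ double) (once-odd-odd (double+-cancel-< 1ℙ i<2N) (double+-cancel-< 1ℙ i'<2N) eqˡ eqʳ)
    ... | even U | odd U' =
      let eqˡ , eqʳ = SameEdge-inj (SameEdge-swapʳ
                        (SameEdge-cong (tour-even U) (tour-odd U) (tour-odd U') (tour-even (suc U')) same))
      in ⊥-elim (once-even-odd (double+-cancel-< 0ℙ i<2N) (double+-cancel-< 1ℙ i'<2N) eqˡ eqʳ)
    ... | odd U | even U' =
      let eqˡ , eqʳ = SameEdge-inj (SameEdge-swapˡ
                        (SameEdge-cong (tour-odd U) (tour-even (suc U)) (tour-even U') (tour-odd U') same))
      in ⊥-elim (once-even-odd (double+-cancel-< 0ℙ i'<2N) (double+-cancel-< 1ℙ i<2N) (sym eqˡ) (sym eqʳ))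

    -- The edge between P j k and B (2j + p) is traversed at unit k + j n when parity k = p,
    -- and otherwise at the unit k' + j n with cyc k' = k, on the way back from B (2j + p).
    covers : ∀ {α β} j k p → j < s → k < n → P j k ≡ α → B (double+ j p) ≡ β →
             ∃[ i ] (i < double N × SameEdge (tour i) (tour (suc i)) (inj₁ α) (inj₂ β))
    covers {α} {β} j k p j<s k<n Pk≡α B≡β with parity k ≟ᵖ p
    ... | yes refl =
      double U , double+-mono-< 0ℙ (block-< k<n j<s) ,
      inj₁ (trans (tour-even U) (cong inj₁ (trans (left-block j k<n) Pk≡α)) ,
            trans (tour-odd U) (cong inj₂ (trans (right-block j k<n) B≡β)))
      where U = k + j * n
    ... | no parity≢p =
      suc (double U) , double+-mono-< 1ℙ (block-< k'<n j<s) ,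
      inj₂ (trans (tour-odd U) (cong inj₂ (trans (right-block j k'<n) right≡β)) ,
            trans (tour-even (suc U)) (cong inj₁ left≡α))
      where
      k' = proj₁ (cyc-surjective k<n)
      k'<n = proj₁ (proj₂ (cyc-surjective k<n))
      cyc≡k = proj₂ (proj₂ (cyc-surjective k<n))
      U = k' + j * n
      left≡α : left (suc U) ≡ α
      left≡α = trans (left-suc U) (trans (cong₂ (λ j' k'' → P j' (cyc k'')) (block-/ j k'<n) (block-% j k'<n))
                 (trans (cong (P j) cyc≡k) Pk≡α))
      right≡β : B (double+ j (parity k')) ≡ β
      right≡β = trans (cong (λ p' → B (double+ j p'))
                  (⁻¹≢⇒≡ (λ eq → parity≢p (trans (cong parity (sym cyc≡k)) (trans (parity-cyc k'<n) eq)))))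
                  B≡β

    tour-every : ∀ α β → ∃[ i ] (i < double N × SameEdge (tour i) (tour (suc i)) (inj₁ α) (inj₂ β))
    tour-every α β =
      let v , v<n , Bv≡β = injectiveBelow⇒surjective B B-injective β
          j , p , double+≡v = double+-surjective v
          j<s = double+-cancel-< p (subst (_< n) (sym double+≡v) v<n)
          k , k<n , Pk≡α = injectiveBelow⇒surjective (P j) (P-injective j j<s) α
      in covers j k p j<s k<n Pk≡α (trans (cong B double+≡v) Bv≡β)

    circuit : EulerianCircuit (K n n) (inj₁ z)
    circuit = record
      { len   = double N
      ; walk  = tour
      ; start = cong inj₁ (trans (left-block 0 z<s) (P-start 0))
      ; end   = trans (tour-even N) (cong inj₁ (trans (left-block s z<s) (P-start s)))
      ; step  = λ i _ → tour-step i
      ; once  = tour-once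
      ; every = λ { (inj₁ α) (inj₂ β) _ → tour-every α β
                  ; (inj₂ β) (inj₁ α) _ → let i , i<2N , same = tour-every α β
                                          in i , i<2N , SameEdge-swapʳ same }
      }
      where
      tour-step : ∀ i → KBip-Adj n n (tour i) (tour (suc i))
      tour-step i with evenOdd i
      ... | even U rewrite tour-even U | tour-odd U = _
      ... | odd U rewrite tour-odd U | tour-even (suc U) = _

-- Circuit number c < n - 1: every round but the last visits the first side in the order
-- c + 1, c + 2, ... modulo n; the last round visits c + 1, c + 2, ... cycling through
-- 1, ..., n - 1 and ends at 0, where the circuit is cut open by rotation.  Round j meets
-- the second-side vertices c + 2j and c + 2j + 1 modulo n.  So at every position two
-- circuits c ≠ c' are at distinct vertices of the same side.
module Shifted (s' : ℕ) where

  open Rounds s' using (s; n)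

  q : ℕ
  q = pred n

  module Family (c : ℕ) where

    shift : ℕ → Fin n
    shift k = (suc c + k) mod n

    lastRound : ℕ → Fin n
    lastRound k with k <? q
    ... | yes _ = fsuc ((c + k) mod q)
    ... | no  _ = fzero

    P : ℕ → ℕ → Fin n
    P j k with j ≟ s'
    ... | yes _ = lastRound k
    ... | no  _ = shift k

    B : ℕ → Fin n
    B v = (c + v) mod n

    lastRound-< : ∀ {k} → k < q → lastRound k ≡ fsuc ((c + k) mod q)
    lastRound-< {k} k<q with k <? q
    ... | yes _   = refl
    ... | no  k≮q = ⊥-elim (k≮q k<q)

    lastRound-q : lastRound q ≡ fzero
    lastRound-q with q <? q
    ... | yes q<q = ⊥-elim (<-irrefl refl q<q)
    ... | no  _   = refl

    lastRound-injective : InjectiveBelow n lastRound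
    lastRound-injective {k} {k'} k<n k'<n eq with k <? q | k' <? q
    ... | yes k<q | yes k'<q = +-%-injectiveʳ c k<q k'<q (mod⇒% (c + k) (c + k') (fsuc-injective eq))
    ... | no  k≮q | no  k'≮q =
      trans (≤-antisym (≤-pred k<n) (≮⇒≥ k≮q)) (sym (≤-antisym (≤-pred k'<n) (≮⇒≥ k'≮q)))
    lastRound-injective _ _ () | yes _ | no _
    lastRound-injective _ _ () | no _  | yes _

    shift-injective : InjectiveBelow n shift
    shift-injective {k} {k'} k<n k'<n eq = +-%-injectiveʳ (suc c) k<n k'<n (mod⇒% (suc c + k) (suc c + k') eq)

    P-injective : ∀ j → j < s → InjectiveBelow n (P j)
    P-injective j _ with j ≟ s'
    ... | yes _ = lastRound-injective
    ... | no  _ = shift-injective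

    B-injective : InjectiveBelow n B
    B-injective {k} {k'} k<n k'<n eq = +-%-injectiveʳ c k<n k'<n (mod⇒% (c + k) (c + k') eq)

    module Rotated (c<q : c < q) where

      P-start : ∀ j → P j 0 ≡ shift 0
      P-start j with j ≟ s'
      ... | no  _ = refl
      ... | yes _ = trans (lastRound-< z<s) (toℕ-injective (begin
        toℕ (fsuc ((c + 0) mod q)) ≡⟨ cong suc (toℕ-fromℕ< (m%n<n (c + 0) q)) ⟩
        suc ((c + 0) % q)   ≡⟨ cong suc (block-% 0 c<q) ⟩
        suc c               ≡⟨ block-% 0 (s<s c<q) ⟨
        (suc c + 0) % n     ≡⟨ toℕ-fromℕ< (m%n<n (suc c + 0) n) ⟨
        toℕ (shift 0)       ∎))
        where open ≡-Reasoning

      open Rounds.Walk s' P B (shift 0) P-injective P-start B-injective public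

      M : ℕ
      M = q + s' * n

      returns-to-0 : tour (double M) ≡ inj₁ fzero
      returns-to-0 = trans (tour-even M) (cong inj₁ (trans (left-block s' (n<1+n q)) P-last))
        where
        P-last : P s' q ≡ fzero
        P-last with s' ≟ s'
        ... | yes _    = lastRound-q
        ... | no  s'≢s' = ⊥-elim (s'≢s' refl)

      shifted : EulerianCircuit (K n n) (inj₁ fzero)
      shifted = rotate (suc (double M)) (rotate (suc (double M)) circuit refl refl) refl returns-to-0

  module _ {c c' : ℕ} (c<q : c < q) (c'<q : c' < q) (c≢c' : c ≢ c') where

    private
      module C  = Family.Rotated c c<q
      module C' = Family.Rotated c' c'<q

    B-separated : ∀ v → Family.B c v ≢ Family.B c' v
    B-separated v eq = c≢c' (+-%-injectiveˡ v (m<n⇒m<1+n c<q) (m<n⇒m<1+n c'<q) (mod⇒% (c + v) (c' + v) eq))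

    P-separated : ∀ j k → (j ≡ s' → k < q) → Family.P c j k ≢ Family.P c' j k
    P-separated j k last⇒k<q with j ≟ s'
    ... | no  _    = λ eq → c≢c' (suc-injective
                       (+-%-injectiveˡ k (s<s c<q) (s<s c'<q) (mod⇒% (suc c + k) (suc c' + k) eq)))
    ... | yes j≡s' = λ eq → c≢c' (+-%-injectiveˡ k c<q c'<q (mod⇒% (c + k) (c' + k)
                       (fsuc-injective (trans (sym (Family.lastRound-< c k<q))
                                              (trans eq (Family.lastRound-< c' k<q))))))
      where k<q = last⇒k<q j≡s'

    left-separated : ∀ {U} → U < C.M → C.left U ≢ C'.left U
    left-separated {U} U<M = P-separated (U / n) (U % n) λ j≡s' →
      +-cancelʳ-< (s' * n) (U % n) q
        (subst (_< C.M) (trans (m≡m%n+[m/n]*n U n) (cong (λ j → U % n + j * n) j≡s')) U<M)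

    shifted-avoiding : Avoiding (K n n) C.shifted C'.shifted
    shifted-avoiding (suc zero) _ _ = K-separated₂ (C.tour-odd C.M) (C'.tour-odd C.M) (B-separated _)
    shifted-avoiding (suc (suc t)) _ (s≤s (s≤s t<2M)) with evenOdd t
    ... | even U = K-separated₁ (C.tour-even U) (C'.tour-even U) (left-separated (double+-cancel-< 0ℙ t<2M))
    ... | odd  U = K-separated₂ (C.tour-odd U) (C'.tour-odd U) (B-separated _)

double≡2* : ∀ m → double m ≡ 2 * m
double≡2* zero    = refl
double≡2* (suc m) = cong suc (trans (cong suc (double≡2* m)) (sym (+-suc m (m + 0))))

av-K-even : ∀ s' → let n = double (suc s') in AvIndexIs (K n n) (pred n)
av-K-even s' =
  transitive⇒hasAvoiding (inj₁ fzero) K-transitive family ,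
  λ k q<k has → <⇒≱ q<k (avoidingCircuits-bound (has (inj₁ fzero)))
  where
  open Rounds s' using (n)
  open Shifted s'
  family : AvoidingCircuits (K n n) q (inj₁ fzero)
  family = (λ c → Family.Rotated.shifted (toℕ c) (toℕ<n c)) ,
           λ c c' c≢c' → shifted-avoiding (toℕ<n c) (toℕ<n c') (c≢c' ∘ toℕ-injective)

theorem10 : ∀ (s : ℕ) → 1 ≤ s → AvIndexIs (K (2 * s) (2 * s)) (2 * s ∸ 1)
theorem10 (suc s') _ = subst (λ n → AvIndexIs (K n n) (pred n)) (double≡2* (suc s')) (av-K-even s')
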